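{- Let $E\subset\mathbb{N}^2$ be finite and $\sigma\subset\mathbb{N}$ be finite and nonempty, and suppose that for every $(a,b)\in E$ there exists $i\in\sigma$ with $a\le i<b$. Then \[ \sum_{(a,b)\in E}(b-a) \ge \frac{|E|^{3/2}}{8\sqrt{|\sigma|}}. \]
   Context: A pair $(E,\sigma)$ satisfying the hypothesis (every pair $(a,b)\in E$, viewed as a bracket, contains a marker $i\in\sigma$ with $a\le i<b$) is called a P2-system. The quantity $\|E\| = \sum_{(a,b)\in E}(b-a)$ is called the extent of $E$. -}

module Defs where

open import Data.Nat using (ℕ; _+_; _∸_; _≤_; _<_)
open import Data.Product using (_×_; _,_; ∃-syntax)
open import Data.List using (List; []; _∷_; length; map)
open import Data.Nat.ListAction using (sum)
open import Data.List.Relation.Unary.All using (All)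
open import Data.List.Membership.Propositional using (_∈_)

-- extent ‖E‖ = Σ_{(a,b) ∈ E} (b - a)   (truncated subtraction; in a P2-system a < b always)
extent : List (ℕ × ℕ) → ℕ
extent E = sum (map (λ p → Data.Product.proj₂ p ∸ Data.Product.proj₁ p) E)

IsP2System : List (ℕ × ℕ) → List ℕ → Set
IsP2System E σ = All (λ p → ∃[ i ] (i ∈ σ × Data.Product.proj₁ p ≤ i × i < Data.Product.proj₂ p)) E

{-# OPTIONS --safe #-}
-- Fix a threshold L. A bracket (a , b) of width at most L is determined by a marker
-- i ∈ σ inside it together with the offsets i ∸ a and b ∸ suc i, both below L, so
-- there are at most |σ| L² such brackets; each of the m wider ones adds more than L
-- to the extent, so (1 + L) m ≤ ‖E‖. Taking L with 2 |σ| L² ≤ |E| < 2 |σ| (1 + L)²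
-- forces |E| ≤ 2 m, hence (1 + L) |E| ≤ 2 ‖E‖ and
-- |E|³ < 2 |σ| (1 + L)² |E|² ≤ 8 |σ| ‖E‖².
module Submission where

open import Defs
open import Data.Bool using (true; false)
open import Data.Nat using (ℕ; zero; suc; _+_; _∸_; _*_; _^_; _≤_; _<_; z≤n; s≤s; _≤?_; _<?_)
open import Data.Nat.Properties
open import Data.Nat.Solver using (module +-*-Solver)
open import Data.Product using (_×_; _,_; ∃-syntax)
open import Data.List using (List; []; _∷_; _++_; length; map; filter; upTo; cartesianProduct)
open import Data.List.Properties using (length-map; length-++; length-upTo; length-removeAt′)
open import Data.List.Relation.Unary.Any using (here; there; index; _─_)
open import Data.List.Relation.Unary.All as All using (All; []; _∷_)
import Data.List.Relation.Unary.All.Properties as All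
open import Data.List.Relation.Unary.AllPairs using ([]; _∷_)
open import Data.List.Relation.Unary.Unique.Propositional using (Unique)
open import Data.List.Relation.Unary.Unique.Propositional.Properties using (filter⁺)
open import Data.List.Membership.Propositional using (_∈_)
open import Data.List.Membership.Propositional.Properties using (∈-map⁺; ∈-upTo⁺; ∈-cartesianProduct⁺)
open import Data.List.Relation.Binary.Subset.Propositional using (_⊆_)
open import Level using (Level)
open import Relation.Binary.PropositionalEquality using (_≡_; _≢_; refl; sym; trans; cong; cong₂; subst)
open import Relation.Nullary using (does; yes; no; contradiction)
open import Relation.Unary using (Pred; Decidable)
open import Relation.Unary.Properties using (∁?)

private
  variable
    ℓ : Level
    A B : Set

∈-─⁺ : ∀ {x y : A} {ys} (x∈ys : x ∈ ys) → y ∈ ys → y ≢ x → y ∈ (ys ─ x∈ys)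
∈-─⁺ (here refl)  (here refl)  y≢x = contradiction refl y≢x
∈-─⁺ (here refl)  (there y∈ys) _   = y∈ys
∈-─⁺ (there _)    (here refl)  _   = here refl
∈-─⁺ (there x∈ys) (there y∈ys) y≢x = there (∈-─⁺ x∈ys y∈ys y≢x)

Unique-⊆⇒length≤ : ∀ {xs ys : List A} → Unique xs → xs ⊆ ys → length xs ≤ length ys
Unique-⊆⇒length≤ []         _     = z≤n
Unique-⊆⇒length≤ {xs = x ∷ xs} {ys} (x∉xs ∷ u) xs⊆ys = begin
  suc (length xs)          ≤⟨ s≤s (Unique-⊆⇒length≤ u xs⊆ys─x) ⟩
  suc (length (ys ─ x∈ys)) ≡⟨ length-removeAt′ ys (index x∈ys) ⟨
  length ys                ∎
  where
  open ≤-Reasoning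
  x∈ys : x ∈ ys
  x∈ys = xs⊆ys (here refl)
  xs⊆ys─x : xs ⊆ (ys ─ x∈ys)
  xs⊆ys─x y∈xs = ∈-─⁺ x∈ys (xs⊆ys (there y∈xs)) (λ y≡x → All.lookup x∉xs y∈xs (sym y≡x))

length-cartesianProduct : ∀ (xs : List A) (ys : List B) →
                          length (cartesianProduct xs ys) ≡ length xs * length ys
length-cartesianProduct []       ys = refl
length-cartesianProduct (x ∷ xs) ys = begin
  length (map (x ,_) ys ++ cartesianProduct xs ys)         ≡⟨ length-++ (map (x ,_) ys) ⟩
  length (map (x ,_) ys) + length (cartesianProduct xs ys)
    ≡⟨ cong₂ _+_ (length-map (x ,_) ys) (length-cartesianProduct xs ys) ⟩
  length ys + length xs * length ys                         ∎
  where open Relation.Binary.PropositionalEquality.≡-Reasoning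

module _ {P : Pred A ℓ} (P? : Decidable P) where

  length-filter+filter-∁ : ∀ xs → length xs ≡ length (filter P? xs) + length (filter (∁? P?) xs)
  length-filter+filter-∁ []       = refl
  length-filter+filter-∁ (x ∷ xs) with does (P? x)
  ... | true  = cong suc (length-filter+filter-∁ xs)
  ... | false = trans (cong suc (length-filter+filter-∁ xs)) (sym (+-suc _ _))

width : ℕ × ℕ → ℕ
width (a , b) = b ∸ a

module _ {P : Pred (ℕ × ℕ) ℓ} (P? : Decidable P) where

  extent-filter : ∀ E → extent (filter P? E) ≤ extent E
  extent-filter []      = z≤n
  extent-filter (p ∷ E) with does (P? p)
  ... | true  = +-monoʳ-≤ (width p) (extent-filter E)
  ... | false = ≤-trans (extent-filter E) (m≤n+m _ (width p))

*-length≤extent : ∀ {k} E → All (λ p → k ≤ width p) E → k * length E ≤ extent E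
*-length≤extent {k} []      []           = ≤-reflexive (*-zeroʳ k)
*-length≤extent {k} (p ∷ E) (k≤p ∷ k≤E) = begin
  k * suc (length E)   ≡⟨ *-suc k (length E) ⟩
  k + k * length E     ≤⟨ +-mono-≤ k≤p (*-length≤extent E k≤E) ⟩
  width p + extent E   ∎
  where open ≤-Reasoning

bracket : ℕ × ℕ × ℕ → ℕ × ℕ
bracket (i , d , e) = (i ∸ d , suc (i + e))

bracket-offsets : ∀ {a b i} → a ≤ i → i < b → bracket (i , i ∸ a , b ∸ suc i) ≡ (a , b)
bracket-offsets a≤i i<b = cong₂ _,_ (m∸[m∸n]≡n a≤i) (m+[n∸m]≡n i<b)

grid : List ℕ → ℕ → List (ℕ × ℕ × ℕ)
grid σ L = cartesianProduct σ (cartesianProduct (upTo L) (upTo L))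

length-grid : ∀ σ L → length (grid σ L) ≡ length σ * (L * L)
length-grid σ L = begin
  length (grid σ L)                                          ≡⟨ length-cartesianProduct σ _ ⟩
  length σ * length (cartesianProduct (upTo L) (upTo L))     ≡⟨ cong (length σ *_) (length-cartesianProduct (upTo L) (upTo L)) ⟩
  length σ * (length (upTo L) * length (upTo L))             ≡⟨ cong (λ n → length σ * (n * n)) (length-upTo L) ⟩
  length σ * (L * L)                                         ∎
  where open Relation.Binary.PropositionalEquality.≡-Reasoning

narrow⊆bracket-grid : ∀ {L} E σ → IsP2System E σ → All (λ p → width p ≤ L) E →
                      E ⊆ map bracket (grid σ L)
narrow⊆bracket-grid {L} E σ P2 narrow {a , b} p∈E with All.lookup P2 p∈E
... | i , i∈σ , a≤i , i<b =
  subst (_∈ map bracket (grid σ L)) (bracket-offsets a≤i i<b)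
    (∈-map⁺ bracket (∈-cartesianProduct⁺ i∈σ (∈-cartesianProduct⁺
      (∈-upTo⁺ (<-≤-trans (∸-monoˡ-< i<b a≤i) w≤L))
      (∈-upTo⁺ (<-≤-trans (∸-monoʳ-< (s≤s a≤i) i<b) w≤L)))))
  where
  w≤L : b ∸ a ≤ L
  w≤L = All.lookup narrow p∈E

length-narrow≤ : ∀ {L} E σ → Unique E → IsP2System E σ → All (λ p → width p ≤ L) E →
                 length E ≤ length σ * (L * L)
length-narrow≤ {L} E σ uE P2 narrow = begin
  length E                        ≤⟨ Unique-⊆⇒length≤ uE (narrow⊆bracket-grid E σ P2 narrow) ⟩
  length (map bracket (grid σ L)) ≡⟨ length-map bracket (grid σ L) ⟩
  length (grid σ L)               ≡⟨ length-grid σ L ⟩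
  length σ * (L * L)              ∎
  where open ≤-Reasoning

narrow-wide-tradeoff : ∀ L E σ → Unique E → IsP2System E σ →
                       ∃[ m ] (length E ≤ length σ * (L * L) + m × suc L * m ≤ extent E)
narrow-wide-tradeoff L E σ uE P2 = length wide , count , wide-extent
  where
  narrow? : Decidable (λ p → width p ≤ L)
  narrow? p = width p ≤? L
  wide : List (ℕ × ℕ)
  wide = filter (∁? narrow?) E
  count : length E ≤ length σ * (L * L) + length wide
  count = begin
    length E                                        ≡⟨ length-filter+filter-∁ narrow? E ⟩
    length (filter narrow? E) + length wide
      ≤⟨ +-monoˡ-≤ (length wide) (length-narrow≤ (filter narrow? E) σ
           (filter⁺ narrow? uE) (All.filter⁺ narrow? P2) (All.all-filter narrow? E)) ⟩
    length σ * (L * L) + length wide                ∎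
    where open ≤-Reasoning
  wide-extent : suc L * length wide ≤ extent E
  wide-extent = ≤-trans (*-length≤extent wide (All.map ≰⇒> (All.all-filter (∁? narrow?) E)))
                        (extent-filter (∁? narrow?) E)

crossing : ∀ (f : ℕ → ℕ) {n} N → f 0 ≤ n → n < f N → ∃[ L ] (f L ≤ n × n < f (suc L))
crossing f zero    f0≤n n<f0 = contradiction n<f0 (≤⇒≯ f0≤n)
crossing f (suc N) f0≤n n<fN+1 with _ <? f N
... | yes n<fN = crossing f N f0≤n n<fN
... | no  n≮fN = N , ≮⇒≥ n≮fN , n<fN+1

cube≤ : ∀ {n s L m X} → 2 * s * (L * L) ≤ n → n < 2 * s * (suc L * suc L) →
        n ≤ s * (L * L) + m → suc L * m ≤ X → n ^ 3 ≤ 64 * s * X ^ 2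
cube≤ {n} {s} {L} {m} {X} lower upper count wide = begin
  n * n ^ 2                           ≤⟨ *-monoˡ-≤ (n ^ 2) (<⇒≤ upper) ⟩
  2 * s * ((1 + L) * (1 + L)) * n ^ 2 ≡⟨ solve 3 (λ s L n → con 2 :* s :* ((con 1 :+ L) :* (con 1 :+ L)) :* n :^ 2
                                             := con 2 :* s :* ((con 1 :+ L) :* n) :^ 2) refl s L n ⟩
  2 * s * ((1 + L) * n) ^ 2           ≤⟨ *-monoʳ-≤ (2 * s) (^-monoˡ-≤ 2 [1+L]n≤2X) ⟩
  2 * s * (2 * X) ^ 2                 ≡⟨ solve 2 (λ s X → con 2 :* s :* (con 2 :* X) :^ 2 := con 8 :* s :* X :^ 2) refl s X ⟩
  8 * s * X ^ 2                       ≤⟨ *-monoˡ-≤ (X ^ 2) (*-monoˡ-≤ s (m≤m+n 8 56)) ⟩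
  64 * s * X ^ 2                      ∎
  where
  open ≤-Reasoning
  open +-*-Solver
  n≤2m : n ≤ 2 * m
  n≤2m = +-cancelˡ-≤ n n (2 * m) (begin
    n + n                                 ≤⟨ +-mono-≤ count count ⟩
    (s * (L * L) + m) + (s * (L * L) + m) ≡⟨ solve 3 (λ s L m → (s :* (L :* L) :+ m) :+ (s :* (L :* L) :+ m)
                                                      := con 2 :* s :* (L :* L) :+ con 2 :* m) refl s L m ⟩
    2 * s * (L * L) + 2 * m               ≤⟨ +-monoˡ-≤ (2 * m) lower ⟩
    n + 2 * m                             ∎)
  [1+L]n≤2X : (1 + L) * n ≤ 2 * X
  [1+L]n≤2X = begin
    (1 + L) * n       ≤⟨ *-monoʳ-≤ (1 + L) n≤2m ⟩
    (1 + L) * (2 * m) ≡⟨ solve 2 (λ L m → (con 1 :+ L) :* (con 2 :* m) := con 2 :* ((con 1 :+ L) :* m)) refl L m ⟩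
    2 * ((1 + L) * m) ≤⟨ *-monoʳ-≤ 2 wide ⟩
    2 * X             ∎

-- A repeated marker only makes length σ larger.
proposition4 : (E : List (ℕ × ℕ)) (σ : List ℕ) → Unique E → Unique σ → 0 < length σ → IsP2System E σ → length E ^ 3 ≤ 64 * length σ * extent E ^ 2
proposition4 E σ uE _ 0<s P2 =
  let L , lower , upper = crossing f (suc n) f0≤n n<f[1+n]
      _ , count , wide  = narrow-wide-tradeoff L E σ uE P2
  in  cube≤ {s = s} {L = L} {X = extent E} lower upper count wide
  where
  n s : ℕ
  n = length E
  s = length σ
  f : ℕ → ℕ
  f L = 2 * s * (L * L)
  f0≤n : f 0 ≤ n
  f0≤n = ≤-trans (≤-reflexive (*-zeroʳ (2 * s))) z≤n
  n<f[1+n] : n < f (suc n)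
  n<f[1+n] = begin-strict
    n                   <⟨ n<1+n n ⟩
    suc n               ≤⟨ m≤m*n (suc n) (suc n) ⟩
    suc n * suc n       ≡⟨ *-identityˡ (suc n * suc n) ⟨
    1 * (suc n * suc n) ≤⟨ *-monoˡ-≤ (suc n * suc n) (≤-trans 0<s (m≤n*m s 2)) ⟩
    f (suc n)           ∎
    where open ≤-Reasoning
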